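{- If $G$ is a graph that is not complete and has $\mathrm{diam}(G)\le 3$, then $$n(G)+\mu_o(G)\le \mu(M(G))\le n(G)+\mu(G)+1.$$ Moreover, if $\mu(M(G))=n(G)+\mu(G)+1$, then every $\mu$-set of $M(G)$ contains $v^*$.
   Context: All graphs are finite and simple; $n(G)$ is the order of $G$ and $\mathrm{diam}(G)$ its diameter. The Mycielskian $M(G)$ has vertex set $V(G)\cup V(G')\cup\{v^*\}$, where $V(G')=\{u': u\in V(G)\}$, and edge set $E(G)\cup\{uv': uv\in E(G)\}\cup\{v'v^*: v'\in V(G')\}$. Given $S\subseteq V(H)$, two vertices $x,y$ of $H$ are $S$-visible if some shortest $x,y$-path in $H$ has no internal vertex in $S$. $S$ is a mutual-visibility set if every two vertices of $S$ are $S$-visible; $\mu(H)$ is the maximum size of such a set, and a mutual-visibility set of that size is a $\mu$-set. $S$ is an outer mutual-visibility set if it is a mutual-visibility set and moreover every pair $u\in S$, $v\in V(H)\setminus S$ is $S$-visible; $\mu_o(H)$ is the maximum size of such a set. -}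

module Defs where

open import Data.Nat using (ℕ; zero; suc; _+_; _≤_)
open import Data.Bool using (Bool; true; false)
open import Data.Fin using (Fin; zero; suc; splitAt)
open import Data.Fin.Subset using (Subset; _∈_; _∉_; ∣_∣)
open import Data.Sum using (_⊎_; inj₁; inj₂)
open import Data.Product using (Σ; ∃; _×_; _,_)
open import Data.Unit using (⊤; tt)
open import Relation.Nullary using (¬_)
open import Relation.Binary.PropositionalEquality using (_≡_; _≢_; refl)

record Graph (n : ℕ) : Set where
  field
    adj    : Fin n → Fin n → Bool
    sym    : ∀ x y → adj x y ≡ adj y x
    irrefl : ∀ x → adj x x ≡ false
open Graph public

Edge : ∀ {n} → Graph n → Fin n → Fin n → Set
Edge G x y = adj G x y ≡ true

data Walk {n} (G : Graph n) : Fin n → Fin n → ℕ → Set where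
  here : ∀ x → Walk G x x 0
  step : ∀ {x y z k} → Edge G x y → Walk G y z k → Walk G x z (suc k)

AllButLastAvoid : ∀ {n} {G : Graph n} {x y k} → Subset n → Walk G x y k → Set
AllButLastAvoid S (here _) = ⊤
AllButLastAvoid S (step {x = x} _ w) = (x ∉ S) × AllButLastAvoid S w

InternalAvoid : ∀ {n} {G : Graph n} {x y k} → Subset n → Walk G x y k → Set
InternalAvoid S (here _) = ⊤
InternalAvoid S (step _ w) = AllButLastAvoid S w

Shortest : ∀ {n} {G : Graph n} {x y k} → Walk G x y k → Set
Shortest {G = G} {x} {y} {k} _ = ∀ m → Walk G x y m → k ≤ m

Visible : ∀ {n} → Graph n → Subset n → Fin n → Fin n → Set
Visible G S x y = Σ ℕ λ k → Σ (Walk G x y k) λ w → Shortest w × InternalAvoid S w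

IsMutualVisibility : ∀ {n} → Graph n → Subset n → Set
IsMutualVisibility G S = ∀ x y → x ∈ S → y ∈ S → Visible G S x y

IsOuterMutualVisibility : ∀ {n} → Graph n → Subset n → Set
IsOuterMutualVisibility G S =
  IsMutualVisibility G S × (∀ u v → u ∈ S → v ∉ S → Visible G S u v)

IsMu : ∀ {n} → Graph n → ℕ → Set
IsMu G k = (∃ λ S → IsMutualVisibility G S × ∣ S ∣ ≡ k)
         × (∀ S → IsMutualVisibility G S → ∣ S ∣ ≤ k)

IsMuO : ∀ {n} → Graph n → ℕ → Set
IsMuO G k = (∃ λ S → IsOuterMutualVisibility G S × ∣ S ∣ ≡ k)
          × (∀ S → IsOuterMutualVisibility G S → ∣ S ∣ ≤ k)

IsMuSet : ∀ {n} → Graph n → Subset n → Set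
IsMuSet G S = IsMutualVisibility G S × (∀ T → IsMutualVisibility G T → ∣ T ∣ ≤ ∣ S ∣)

Complete : ∀ {n} → Graph n → Set
Complete G = ∀ x y → x ≢ y → Edge G x y

DiamAtMost : ∀ {n} → Graph n → ℕ → Set
DiamAtMost G d = ∀ x y → Σ ℕ λ k → k ≤ d × Walk G x y k

data MV (n : ℕ) : Set where
  orig : Fin n → MV n
  copy : Fin n → MV n
  star : MV n

madj : ∀ {n} → Graph n → MV n → MV n → Bool
madj G (orig u) (orig v) = adj G u v
madj G (orig u) (copy v) = adj G u v
madj G (copy u) (orig v) = adj G u v
madj G (copy u) (copy v) = false
madj G (copy u) star = true
madj G star (copy v) = true
madj G (orig u) star = false
madj G star (orig v) = false
madj G star star = false

madj-sym : ∀ {n} (G : Graph n) a b → madj G a b ≡ madj G b a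
madj-sym G (orig u) (orig v) = sym G u v
madj-sym G (orig u) (copy v) = sym G u v
madj-sym G (copy u) (orig v) = sym G u v
madj-sym G (copy u) (copy v) = refl
madj-sym G (copy u) star = refl
madj-sym G star (copy v) = refl
madj-sym G (orig u) star = refl
madj-sym G star (orig v) = refl
madj-sym G star star = refl

madj-irrefl : ∀ {n} (G : Graph n) a → madj G a a ≡ false
madj-irrefl G (orig u) = irrefl G u
madj-irrefl G (copy u) = refl
madj-irrefl G star = refl

-- Encoding of V(M(G)) as Fin (1 + (n + n)): 0 ↦ v*, 1+i ↦ u (i < n) or u' (i ≥ n).
decode : ∀ {n} → Fin (suc (n + n)) → MV n
decode zero = star
decode {n} (suc i) with splitAt n i
... | inj₁ u = orig u
... | inj₂ u = copy u

Mycielski : ∀ {n} → Graph n → Graph (suc (n + n))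
Mycielski G = record
  { adj    = λ i j → madj G (decode i) (decode j)
  ; sym    = λ i j → madj-sym G (decode i) (decode j)
  ; irrefl = λ i → madj-irrefl G (decode i)
  }

vstar : ∀ n → Fin (suc (n + n))
vstar n = zero

-- A walk of M(G) between vertices x, y other than v* either passes through v*, and then has
-- length at least d(x, v*) + d(y, v*), or projects (u, u′ ↦ u) onto a walk of G of the same
-- length. Since diam G ≤ 3 while d(x, v*) + d(y, v*) ≥ 3 when x is an original vertex, a walk
-- from an original vertex is shortest in M(G) as soon as its projection is shortest in G.
--
-- Lower bound: for an outer mutual-visibility set S of G, S ∪ V(G′) is mutual-visibility in
-- M(G). Copies see each other through v*; shortest paths of G from S to any vertex lift to
-- M(G), ending in a copy where needed, and u sees u′ along u, z, u′ with z ∉ S a neighbour.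
--
-- Upper bound: let T be mutual-visibility in M(G), with traces A on V(G) and B on V(G′).
-- Then A ∩ B is mutual-visibility in G: for x, y ∈ A ∩ B a shortest x,y-path of M(G) has
-- length ≤ 3, so it projects, and the projection avoids A ∩ B internally since u ∈ A ∩ B
-- puts both u and u′ in T. Hence |T ∖ {v*}| = |A| + |B| ≤ |A ∩ B| + n ≤ μ(G) + n,
-- which also shows that a mutual-visibility set of size n + μ(G) + 1 contains v*.

module Submission where

open import Defs hiding (sym)
open import Data.Nat using (ℕ; suc; _+_; _≤_; _<_; z≤n; s≤s)
open import Data.Nat.Properties
  using (module ≤-Reasoning; ≤-refl; ≤-trans; <-≤-trans; <-irrefl; +-suc; +-comm; +-monoˡ-≤; n≤1+n; m≤n⇒m≤1+n)
open import Data.Bool using (true; false)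
open import Data.Fin using (Fin; _↑ˡ_; _↑ʳ_; splitAt) renaming (zero to fzero; suc to fsuc; _≟_ to _≟ᶠ_)
open import Data.Fin.Properties using (splitAt-↑ˡ; splitAt-↑ʳ; splitAt⁻¹-↑ˡ; splitAt⁻¹-↑ʳ; ¬∀⟶∃¬)
open import Data.Fin.Subset using (Subset; _∈_; _∉_; ∣_∣; _∩_; ⊤; ⊥)
open import Data.Fin.Subset.Properties using (_∈?_; ∉⊥; ∣⊤∣≡n; x∈p∩q⁻)
open import Data.Vec using ([]; _∷_; _++_; here; there)
open import Data.Vec.Properties using (lookup-++ˡ; lookup-++ʳ; []=⇒lookup; lookup⇒[]=)
import Data.Vec as Vec
open import Data.Product using (Σ-syntax; ∃; _×_; _,_; proj₁; proj₂)
open import Data.Sum using (_⊎_; inj₁; inj₂)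
open import Data.Empty using (⊥-elim)
open import Data.Unit using (tt) renaming (⊤ to Unit)
open import Relation.Nullary using (¬_; yes; no)
open import Data.Bool.Properties using (not-¬)
open import Function using (_∘_)
open import Relation.Binary.PropositionalEquality using (_≡_; _≢_; refl; sym; trans; cong; subst; subst₂)

module _ {n} {G : Graph n} where

  Edge-sym : ∀ {x y} → Edge G x y → Edge G y x
  Edge-sym {x} {y} e = trans (Graph.sym G y x) e

  snoc : ∀ {x y z k} → Walk G x y k → Edge G y z → Walk G x z (suc k)
  snoc (here _)   e′ = step e′ (here _)
  snoc (step e w) e′ = step e (snoc w e′)

  reverse : ∀ {x y k} → Walk G x y k → Walk G y x k
  reverse (here x)   = here x
  reverse (step e w) = snoc (reverse w) (Edge-sym e)

  AllAvoid : ∀ {x y k} → Subset n → Walk G x y k → Set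
  AllAvoid S (here x)           = x ∉ S
  AllAvoid S (step {x = x} _ w) = x ∉ S × AllAvoid S w

  AllButFirstAvoid : ∀ {x y k} → Subset n → Walk G x y k → Set
  AllButFirstAvoid S (here _)   = Unit
  AllButFirstAvoid S (step _ w) = AllAvoid S w

  AllAvoid-snoc : ∀ {S x y z k} (w : Walk G x y k) (e : Edge G y z) →
                  AllAvoid S w → z ∉ S → AllAvoid S (snoc w e)
  AllAvoid-snoc (here _)   e y∉S          z∉S = y∉S , z∉S
  AllAvoid-snoc (step _ w) e (x∉S , rest) z∉S = x∉S , AllAvoid-snoc w e rest z∉S

  AllButFirstAvoid-snoc : ∀ {S x y z k} (w : Walk G x y k) (e : Edge G y z) →
                          AllButFirstAvoid S w → z ∉ S → AllButFirstAvoid S (snoc w e)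
  AllButFirstAvoid-snoc (here _)   e _    z∉S = z∉S
  AllButFirstAvoid-snoc (step _ w) e rest z∉S = AllAvoid-snoc w e rest z∉S

  AllButLastAvoid-snoc : ∀ {S x y z k} (w : Walk G x y k) (e : Edge G y z) →
                         AllAvoid S w → AllButLastAvoid S (snoc w e)
  AllButLastAvoid-snoc (here _)   e y∉S          = y∉S , tt
  AllButLastAvoid-snoc (step _ w) e (x∉S , rest) = x∉S , AllButLastAvoid-snoc w e rest

  InternalAvoid-snoc : ∀ {S x y z k} (w : Walk G x y k) (e : Edge G y z) →
                       AllButFirstAvoid S w → InternalAvoid S (snoc w e)
  InternalAvoid-snoc (here _)   e _    = tt
  InternalAvoid-snoc (step _ w) e rest = AllButLastAvoid-snoc w e rest

  AllButLastAvoid-reverse : ∀ {S x y k} (w : Walk G x y k) →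
                            AllButLastAvoid S w → AllButFirstAvoid S (reverse w)
  AllButLastAvoid-reverse (here _)   _            = tt
  AllButLastAvoid-reverse (step e w) (x∉S , rest) =
    AllButFirstAvoid-snoc (reverse w) (Edge-sym e) (AllButLastAvoid-reverse w rest) x∉S

  InternalAvoid-reverse : ∀ {S x y k} (w : Walk G x y k) →
                          InternalAvoid S w → InternalAvoid S (reverse w)
  InternalAvoid-reverse (here _)   _    = tt
  InternalAvoid-reverse (step e w) rest =
    InternalAvoid-snoc (reverse w) (Edge-sym e) (AllButLastAvoid-reverse w rest)

  Visible-sym : ∀ {S x y} → Visible G S x y → Visible G S y x
  Visible-sym (k , w , shortest , avoid) =
    k , reverse w , (λ m w′ → shortest m (reverse w′)) , InternalAvoid-reverse w avoid

  length≥2 : ∀ {x y m} → Walk G x y m → x ≢ y → ¬ Edge G x y → 2 ≤ m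
  length≥2 (here _)            x≢y _     = ⊥-elim (x≢y refl)
  length≥2 (step e (here _))   _   ¬edge = ⊥-elim (¬edge e)
  length≥2 (step _ (step _ _)) _   _     = s≤s (s≤s z≤n)

  Shortest⇒≤diam : ∀ {d x y k} → DiamAtMost G d → (w : Walk G x y k) → Shortest w → k ≤ d
  Shortest⇒≤diam {x = x} {y} diam w shortest with diam x y
  ... | (_ , k≤d , w′) = ≤-trans (shortest _ w′) k≤d

  -- A shortest path whose interior avoids the full vertex set has length at most 1.
  mutualVisibility-missesVertex : ∀ {S} → ¬ Complete G → IsMutualVisibility G S → ∃ λ z → z ∉ S
  mutualVisibility-missesVertex {S} ¬complete mv =
    ¬∀⟶∃¬ n (_∈ S) (_∈? S) λ all∈S → ¬complete λ x y x≢y →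
      let (_ , w , _ , avoid) = mv x y (all∈S x) (all∈S y) in edge w x≢y avoid all∈S
    where
    edge : ∀ {x y k} (w : Walk G x y k) → x ≢ y → InternalAvoid S w → (∀ z → z ∈ S) → Edge G x y
    edge (here _)            x≢y _         _     = ⊥-elim (x≢y refl)
    edge (step e (here _))   _   _         _     = e
    edge (step _ (step _ _)) _   (z∉S , _) all∈S = ⊥-elim (z∉S (all∈S _))

  exitNeighbour : ∀ {S u v} → u ∈ S → v ∉ S → Visible G S u v → ∃ λ z → Edge G u z × z ∉ S
  exitNeighbour u∈S v∉S (_ , here _ , _)                      = ⊥-elim (v∉S u∈S)
  exitNeighbour u∈S v∉S (_ , step e (here _) , _)             = _ , e , v∉S
  exitNeighbour u∈S v∉S (_ , step e (step _ _) , _ , z∉S , _) = _ , e , z∉S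

∣p++q∣≡∣p∣+∣q∣ : ∀ {m k} (p : Subset m) (q : Subset k) → ∣ p ++ q ∣ ≡ ∣ p ∣ + ∣ q ∣
∣p++q∣≡∣p∣+∣q∣ []          q = refl
∣p++q∣≡∣p∣+∣q∣ (true ∷ p)  q = cong suc (∣p++q∣≡∣p∣+∣q∣ p q)
∣p++q∣≡∣p∣+∣q∣ (false ∷ p) q = ∣p++q∣≡∣p∣+∣q∣ p q

∣p∣+∣q∣≤∣p∩q∣+n : ∀ {n} (p q : Subset n) → ∣ p ∣ + ∣ q ∣ ≤ ∣ p ∩ q ∣ + n
∣p∣+∣q∣≤∣p∩q∣+n []          []          = z≤n
∣p∣+∣q∣≤∣p∩q∣+n {suc n} (true ∷ p) (true ∷ q)
  rewrite +-suc ∣ p ∣ ∣ q ∣ | +-suc ∣ p ∩ q ∣ n = s≤s (s≤s (∣p∣+∣q∣≤∣p∩q∣+n p q))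
∣p∣+∣q∣≤∣p∩q∣+n {suc n} (true ∷ p) (false ∷ q)
  rewrite +-suc ∣ p ∩ q ∣ n = s≤s (∣p∣+∣q∣≤∣p∩q∣+n p q)
∣p∣+∣q∣≤∣p∩q∣+n {suc n} (false ∷ p) (true ∷ q)
  rewrite +-suc ∣ p ∣ ∣ q ∣ | +-suc ∣ p ∩ q ∣ n = s≤s (∣p∣+∣q∣≤∣p∩q∣+n p q)
∣p∣+∣q∣≤∣p∩q∣+n {suc n} (false ∷ p) (false ∷ q)
  rewrite +-suc ∣ p ∩ q ∣ n = m≤n⇒m≤1+n (∣p∣+∣q∣≤∣p∩q∣+n p q)

∣x∷p∣≤1+∣p∣ : ∀ {m} x (p : Subset m) → ∣ x ∷ p ∣ ≤ suc ∣ p ∣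
∣x∷p∣≤1+∣p∣ true  p = ≤-refl
∣x∷p∣≤1+∣p∣ false p = m≤n⇒m≤1+n ≤-refl

module _ {n : ℕ} where

  encode : MV n → Fin (suc (n + n))
  encode (orig u) = fsuc (u ↑ˡ n)
  encode (copy u) = fsuc (n ↑ʳ u)
  encode star     = fzero

  decode-encode : ∀ a → decode (encode a) ≡ a
  decode-encode (orig u) rewrite splitAt-↑ˡ n u n = refl
  decode-encode (copy u) rewrite splitAt-↑ʳ n n u = refl
  decode-encode star     = refl

  encode-decode : ∀ i → encode (decode i) ≡ i
  encode-decode fzero = refl
  encode-decode (fsuc i) with splitAt n i in eq
  ... | inj₁ u = cong fsuc (splitAt⁻¹-↑ˡ eq)
  ... | inj₂ u = cong fsuc (splitAt⁻¹-↑ʳ eq)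

  decode≡⇒encode≡ : ∀ {i a} → decode i ≡ a → encode a ≡ i
  decode≡⇒encode≡ {i} p = trans (cong encode (sym p)) (encode-decode i)

  encode-injective : ∀ {a b} → encode a ≡ encode b → a ≡ b
  encode-injective {a} {b} eq =
    trans (sym (decode-encode a)) (trans (cong decode eq) (decode-encode b))

  data Encoded : Fin (suc (n + n)) → Set where
    enc : ∀ a → Encoded (encode a)

  encoded : ∀ i → Encoded i
  encoded i = subst Encoded (encode-decode i) (enc (decode i))

  orig∈⁺ : ∀ {t A B u} → u ∈ A → encode (orig u) ∈ t ∷ (A ++ B)
  orig∈⁺ {A = A} {B} {u} u∈A =
    there (lookup⇒[]= (u ↑ˡ n) (A ++ B) (trans (lookup-++ˡ A B u) ([]=⇒lookup u∈A)))

  orig∈⁻ : ∀ {t A B u} → encode (orig u) ∈ t ∷ (A ++ B) → u ∈ A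
  orig∈⁻ {A = A} {B} {u} (there o∈T) =
    lookup⇒[]= u A (trans (sym (lookup-++ˡ A B u)) ([]=⇒lookup o∈T))

  copy∈⁺ : ∀ {t A B u} → u ∈ B → encode (copy u) ∈ t ∷ (A ++ B)
  copy∈⁺ {A = A} {B} {u} u∈B =
    there (lookup⇒[]= (n ↑ʳ u) (A ++ B) (trans (lookup-++ʳ A B u) ([]=⇒lookup u∈B)))

  -- i is u or u′; starDist is then the distance from i to v* in M(G).
  data _LiesOver_ (i : Fin (suc (n + n))) (u : Fin n) : Set where
    asOrig : decode i ≡ orig u → i LiesOver u
    asCopy : decode i ≡ copy u → i LiesOver u

  origLiesOver : ∀ u → encode (orig u) LiesOver u
  origLiesOver u = asOrig (decode-encode (orig u))

  copyLiesOver : ∀ u → encode (copy u) LiesOver u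
  copyLiesOver u = asCopy (decode-encode (copy u))

  outerLift : Subset n → Subset (suc (n + n))
  outerLift S = false ∷ (S ++ ⊤)

  ∣outerLift∣ : ∀ S → ∣ outerLift S ∣ ≡ ∣ S ∣ + n
  ∣outerLift∣ S = trans (∣p++q∣≡∣p∣+∣q∣ S ⊤) (cong (∣ S ∣ +_) (∣⊤∣≡n n))

  -- Both u and u′ belong to t ∷ (A ++ B) whenever u ∈ A ∩ B.
  LiesOver-∉-∩ : ∀ {t} {A B : Subset n} {i u} → i LiesOver u → i ∉ t ∷ (A ++ B) → u ∉ A ∩ B
  LiesOver-∉-∩ {A = A} {B} (asOrig p) i∉ u∈A∩B =
    i∉ (subst (_∈ _) (decode≡⇒encode≡ p) (orig∈⁺ (proj₁ (x∈p∩q⁻ A B u∈A∩B))))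
  LiesOver-∉-∩ {A = A} {B} (asCopy p) i∉ u∈A∩B =
    i∉ (subst (_∈ _) (decode≡⇒encode≡ p) (copy∈⁺ {A = A} (proj₂ (x∈p∩q⁻ A B u∈A∩B))))

  starDist : ∀ {i u} → i LiesOver u → ℕ
  starDist (asOrig _) = 2
  starDist (asCopy _) = 1

  starDist≤1+starDist : ∀ {i j u v} (ci : i LiesOver u) (cj : j LiesOver v) →
                        starDist ci ≤ suc (starDist cj)
  starDist≤1+starDist (asOrig _) (asOrig _) = s≤s (s≤s z≤n)
  starDist≤1+starDist (asOrig _) (asCopy _) = ≤-refl
  starDist≤1+starDist (asCopy _) _          = s≤s z≤n

  LiesOver-unique : ∀ {i u v} → i LiesOver u → i LiesOver v → u ≡ v
  LiesOver-unique (asOrig p) (asOrig q) with trans (sym p) q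
  ... | refl = refl
  LiesOver-unique (asOrig p) (asCopy q) with trans (sym p) q
  ... | ()
  LiesOver-unique (asCopy p) (asOrig q) with trans (sym p) q
  ... | ()
  LiesOver-unique (asCopy p) (asCopy q) with trans (sym p) q
  ... | refl = refl

module _ {n} (G : Graph n) where

  private
    M : Graph (suc (n + n))
    M = Mycielski G

    _~_ : MV n → MV n → Set
    a ~ b = madj G a b ≡ true

    star≢orig : ∀ {u : Fin n} → star ≢ orig u
    star≢orig ()

    star≢copy : ∀ {u : Fin n} → star ≢ copy u
    star≢copy ()

    orig≢copy : ∀ {u v : Fin n} → orig u ≢ copy v
    orig≢copy ()

    copy-injective : ∀ {u v : Fin n} → copy u ≡ copy v → u ≡ v
    copy-injective refl = refl

  Edge-encode⁺ : ∀ {a b} → a ~ b → Edge M (encode a) (encode b)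
  Edge-encode⁺ {a} {b} = subst₂ _~_ (sym (decode-encode a)) (sym (decode-encode b))

  Edge-encode⁻ : ∀ {a b} → Edge M (encode a) (encode b) → a ~ b
  Edge-encode⁻ {a} {b} = subst₂ _~_ (decode-encode a) (decode-encode b)

  Edge-LiesOver : ∀ {i j u v} → i LiesOver u → j LiesOver v → Edge M i j → Edge G u v
  Edge-LiesOver (asOrig p) (asOrig q) e = subst₂ _~_ p q e
  Edge-LiesOver (asOrig p) (asCopy q) e = subst₂ _~_ p q e
  Edge-LiesOver (asCopy p) (asOrig q) e = subst₂ _~_ p q e
  Edge-LiesOver (asCopy p) (asCopy q) e with subst₂ _~_ p q e
  ... | ()

  starDist-fromStar : ∀ {i j v m} → Walk M i j m → decode {n} i ≡ star → (cj : j LiesOver v) →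
                      starDist cj ≤ m
  starDist-fromStar (here _)            s (asOrig p) = ⊥-elim (star≢orig (trans (sym s) p))
  starDist-fromStar (here _)            s (asCopy p) = ⊥-elim (star≢copy (trans (sym s) p))
  starDist-fromStar (step _ _)          _ (asCopy _) = s≤s z≤n
  starDist-fromStar (step e (here _))   s (asOrig p) with subst₂ _~_ s p e
  ... | ()
  starDist-fromStar (step _ (step _ _)) _ (asOrig _) = s≤s (s≤s z≤n)

  module Projection (T : Subset (suc (n + n))) (S : Subset n)
                    (shadow∉ : ∀ {i u} → i LiesOver u → i ∉ T → u ∉ S) where

    AvoidanceTransfers : ∀ {i j u v m} → Walk M i j m → Walk G u v m → Set
    AvoidanceTransfers w w′ = (AllButLastAvoid T w → AllButLastAvoid S w′)
                            × (InternalAvoid T w → InternalAvoid S w′)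

    ViaStarOrProjects : ∀ {i j u v m} → Walk M i j m → i LiesOver u → j LiesOver v → Set
    ViaStarOrProjects {u = u} {v} {m} w ci cj =
      starDist ci + starDist cj ≤ m ⊎ (Σ[ w′ ∈ Walk G u v m ] AvoidanceTransfers w w′)

    private
      viaStar : ∀ {i j} {u v : Fin n} {m} (ci : i LiesOver u) {cj : j LiesOver v} →
                Edge M i fzero → starDist cj ≤ m → starDist ci + starDist cj ≤ suc m
      viaStar (asOrig p) e _ with subst₂ _~_ p refl e
      ... | ()
      viaStar (asCopy _) _ far = s≤s far

      extend : ∀ {i y j} {u z v : Fin n} {m}
               (ci : i LiesOver u) (cy : y LiesOver z) {cj : j LiesOver v}
               (e : Edge M i y) {w : Walk M y j m} →
               ViaStarOrProjects w cy cj → ViaStarOrProjects (step e w) ci cj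
      extend ci cy e (inj₁ far) = inj₁ (≤-trans (+-monoˡ-≤ _ (starDist≤1+starDist ci cy)) (s≤s far))
      extend ci cy e (inj₂ (w′ , allButLast , _)) =
        inj₂ ( step (Edge-LiesOver ci cy e) w′
             , (λ (i∉T , rest) → shadow∉ ci i∉T , allButLast rest)
             , allButLast)

    project : ∀ {i j u v m} (w : Walk M i j m) (ci : i LiesOver u) (cj : j LiesOver v) →
              ViaStarOrProjects w ci cj
    project (here _) ci cj with LiesOver-unique ci cj
    ... | refl = inj₂ (here _ , (λ _ → tt) , (λ _ → tt))
    project (step {y = y} e w) ci cj with encoded {n} y
    ... | enc (orig z) = extend ci (origLiesOver z) e (project w (origLiesOver z) cj)
    ... | enc (copy z) = extend ci (copyLiesOver z) e (project w (copyLiesOver z) cj)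
    ... | enc star     = inj₁ (viaStar ci {cj = cj} e (starDist-fromStar w refl cj))

  lift : ∀ {u v k} → Walk G u v k → Walk M (encode (orig u)) (encode (orig v)) k
  lift (here _)   = here _
  lift (step e w) = step (Edge-encode⁺ {orig _} {orig _} e) (lift w)

  liftToCopy : ∀ {u v k} → Walk G u v (suc k) → Walk M (encode (orig u)) (encode (copy v)) (suc k)
  liftToCopy (step e (here _))     = step (Edge-encode⁺ {orig _} {copy _} e) (here _)
  liftToCopy (step e w@(step _ _)) = step (Edge-encode⁺ {orig _} {orig _} e) (liftToCopy w)

  module _ {T : Subset (suc (n + n))} {S : Subset n}
           (orig∉ : ∀ {z} → z ∉ S → encode (orig z) ∉ T) where

    AllButLastAvoid-lift : ∀ {u v k} (w : Walk G u v k) →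
                           AllButLastAvoid S w → AllButLastAvoid T (lift w)
    AllButLastAvoid-lift (here _)   _            = tt
    AllButLastAvoid-lift (step _ w) (x∉S , rest) = orig∉ x∉S , AllButLastAvoid-lift w rest

    InternalAvoid-lift : ∀ {u v k} (w : Walk G u v k) → InternalAvoid S w → InternalAvoid T (lift w)
    InternalAvoid-lift (here _)   _    = tt
    InternalAvoid-lift (step _ w) rest = AllButLastAvoid-lift w rest

    AllButLastAvoid-liftToCopy : ∀ {u v k} (w : Walk G u v (suc k)) →
                                 AllButLastAvoid S w → AllButLastAvoid T (liftToCopy w)
    AllButLastAvoid-liftToCopy (step _ (here _))     (x∉S , _)    = orig∉ x∉S , tt
    AllButLastAvoid-liftToCopy (step _ w@(step _ _)) (x∉S , rest) =
      orig∉ x∉S , AllButLastAvoid-liftToCopy w rest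

    InternalAvoid-liftToCopy : ∀ {u v k} (w : Walk G u v (suc k)) →
                               InternalAvoid S w → InternalAvoid T (liftToCopy w)
    InternalAvoid-liftToCopy (step _ (here _))     _    = tt
    InternalAvoid-liftToCopy (step _ w@(step _ _)) rest = AllButLastAvoid-liftToCopy w rest

  Shortest-LiesOver : DiamAtMost G 3 → ∀ {i j} {u v : Fin n} {k}
                  (ci : i LiesOver u) (cj : j LiesOver v) → 3 ≤ starDist ci + starDist cj →
                  (w : Walk G u v k) → Shortest w → (w′ : Walk M i j k) → Shortest w′
  Shortest-LiesOver diam ci cj 3≤starDists w shortest _ m w″
    with Projection.project ⊥ ⊥ (λ _ _ → ∉⊥) w″ ci cj
  ... | inj₁ far        = ≤-trans (Shortest⇒≤diam diam w shortest) (≤-trans 3≤starDists far)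
  ... | inj₂ (w‴ , _)   = shortest m w‴

  origDistance≤3 : DiamAtMost G 3 → ∀ {x y m} (w : Walk M (encode (orig x)) (encode (orig y)) m) →
                   Shortest w → m ≤ 3
  origDistance≤3 diam {x} {y} _ shortest with diam x y
  ... | (_ , k≤3 , w′) = ≤-trans (shortest _ (lift w′)) k≤3

  mutualVisibility-restrict : DiamAtMost G 3 → ∀ {t} {A B : Subset n} →
                              IsMutualVisibility M (t ∷ (A ++ B)) → IsMutualVisibility G (A ∩ B)
  mutualVisibility-restrict diam {t} {A} {B} mv x y x∈A∩B y∈A∩B
    with mv _ _ (orig∈⁺ (proj₁ (x∈p∩q⁻ A B x∈A∩B))) (orig∈⁺ (proj₁ (x∈p∩q⁻ A B y∈A∩B)))
  ... | (m , w , shortest , avoid)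
    with Projection.project (t ∷ (A ++ B)) (A ∩ B) LiesOver-∉-∩ w (origLiesOver x) (origLiesOver y)
  ...   | inj₁ far = ⊥-elim (<-irrefl refl (≤-trans far (origDistance≤3 diam w shortest)))
  ...   | inj₂ (w′ , _ , transfer) = m , w′ , (λ k w″ → shortest k (lift w″)) , transfer avoid

  module _ (diam : DiamAtMost G 3) {c} (μ≤c : ∀ S → IsMutualVisibility G S → ∣ S ∣ ≤ c) where

    mutualVisibility-∣nonStar∣≤ : ∀ t R → IsMutualVisibility M (t ∷ R) → ∣ R ∣ ≤ c + n
    mutualVisibility-∣nonStar∣≤ t R mv with Vec.splitAt n R
    ... | (A , B , refl) = begin
      ∣ A ++ B ∣        ≡⟨ ∣p++q∣≡∣p∣+∣q∣ A B ⟩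
      ∣ A ∣ + ∣ B ∣     ≤⟨ ∣p∣+∣q∣≤∣p∩q∣+n A B ⟩
      ∣ A ∩ B ∣ + n     ≤⟨ +-monoˡ-≤ n (μ≤c _ (mutualVisibility-restrict diam {t} {A} {B} mv)) ⟩
      c + n             ∎
      where open ≤-Reasoning

    private
      1+c+n≡n+c+1 : suc (c + n) ≡ n + c + 1
      1+c+n≡n+c+1 = trans (cong suc (+-comm c n)) (+-comm 1 (n + c))

    mutualVisibility-size≤ : ∀ S → IsMutualVisibility M S → ∣ S ∣ ≤ n + c + 1
    mutualVisibility-size≤ (t ∷ R) mv = subst (∣ t ∷ R ∣ ≤_) 1+c+n≡n+c+1
      (≤-trans (∣x∷p∣≤1+∣p∣ t R) (s≤s (mutualVisibility-∣nonStar∣≤ t R mv)))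

    starFree-mutualVisibility-size< : ∀ S → vstar n ∉ S → IsMutualVisibility M S → ∣ S ∣ < n + c + 1
    starFree-mutualVisibility-size< (true ∷ R)  v*∉S _  = ⊥-elim (v*∉S here)
    starFree-mutualVisibility-size< (false ∷ R) _    mv =
      subst (∣ R ∣ <_) 1+c+n≡n+c+1 (s≤s (mutualVisibility-∣nonStar∣≤ false R mv))

  twinDistance≥2 : ∀ {u m} → Walk M (encode (orig u)) (encode (copy u)) m → 2 ≤ m
  twinDistance≥2 {u} w = length≥2 w (λ eq → orig≢copy (encode-injective eq))
                                    (not-¬ (irrefl G u) ∘ Edge-encode⁻ {orig u} {copy u})

  copyDistance≥2 : ∀ {u v m} → u ≢ v → Walk M (encode (copy u)) (encode (copy v)) m → 2 ≤ m
  copyDistance≥2 {u} {v} u≢v w = length≥2 w (λ eq → u≢v (copy-injective (encode-injective eq)))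
                                            (not-¬ refl ∘ Edge-encode⁻ {copy u} {copy v})

  module _ (diam : DiamAtMost G 3) (¬complete : ¬ Complete G) {S : Subset n}
           (outer : IsOuterMutualVisibility G S) where

    private
      orig∈⁻ₛ : ∀ {u} → encode (orig u) ∈ outerLift S → u ∈ S
      orig∈⁻ₛ = orig∈⁻ {A = S} {B = ⊤}

      orig∉ : ∀ {z} → z ∉ S → encode (orig z) ∉ outerLift S
      orig∉ z∉S = z∉S ∘ orig∈⁻ₛ

      star∉ : encode {n} star ∉ outerLift S
      star∉ ()

      visibleFrom : ∀ {u} → u ∈ S → ∀ v → Visible G S u v
      visibleFrom u∈S v with v ∈? S
      ... | yes v∈S = proj₁ outer _ _ u∈S v∈S
      ... | no  v∉S = proj₂ outer _ _ u∈S v∉S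

    visible-orig-orig : ∀ {u v} → u ∈ S → v ∈ S →
                        Visible M (outerLift S) (encode (orig u)) (encode (orig v))
    visible-orig-orig {u} {v} u∈S v∈S with proj₁ outer u v u∈S v∈S
    ... | (k , w , shortest , avoid) =
      k , lift w
        , Shortest-LiesOver diam (origLiesOver u) (origLiesOver v) (n≤1+n 3) w shortest (lift w)
        , InternalAvoid-lift orig∉ w avoid

    visible-orig-copy : ∀ {u} → u ∈ S → ∀ v →
                        Visible M (outerLift S) (encode (orig u)) (encode (copy v))
    visible-orig-copy {u} u∈S v with u ≟ᶠ v
    ... | no u≢v = liftVisible u≢v (visibleFrom u∈S v)
      where
      liftVisible : u ≢ v → Visible G S u v →
                    Visible M (outerLift S) (encode (orig u)) (encode (copy v))
      liftVisible u≢v (_ , here _ , _) = ⊥-elim (u≢v refl)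
      liftVisible _ (suc k , w , shortest , avoid) =
        suc k , liftToCopy w
              , Shortest-LiesOver diam (origLiesOver u) (copyLiesOver v) ≤-refl w shortest (liftToCopy w)
              , InternalAvoid-liftToCopy orig∉ w avoid
    -- Go u, z, u′ for a neighbour z ∉ S of u; it exists as S misses a vertex and is outer.
    ... | yes refl with mutualVisibility-missesVertex ¬complete (proj₁ outer)
    ...   | (v₀ , v₀∉S) with exitNeighbour u∈S v₀∉S (proj₂ outer u v₀ u∈S v₀∉S)
    ...     | (z , e , z∉S) =
      2 , step {y = encode (orig z)} (Edge-encode⁺ {orig u} {orig z} e)
               (step (Edge-encode⁺ {orig z} {copy u} (Edge-sym {G = G} e)) (here _))
        , (λ _ w′ → twinDistance≥2 w′) , orig∉ z∉S , tt

    visible-copy-copy : ∀ u v → Visible M (outerLift S) (encode (copy u)) (encode (copy v))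
    visible-copy-copy u v with u ≟ᶠ v
    ... | yes refl = 0 , here _ , (λ _ _ → z≤n) , tt
    ... | no u≢v   =
      2 , step {y = encode {n} star} (Edge-encode⁺ {copy u} {star} refl)
               (step (Edge-encode⁺ {star} {copy v} refl) (here _))
        , (λ _ w′ → copyDistance≥2 u≢v w′) , star∉ , tt

    outerLift-mutualVisibility : IsMutualVisibility M (outerLift S)
    outerLift-mutualVisibility i j i∈ j∈ with encoded {n} i | encoded {n} j
    ... | enc star     | _            = ⊥-elim (star∉ i∈)
    ... | enc (orig _) | enc star     = ⊥-elim (star∉ j∈)
    ... | enc (copy _) | enc star     = ⊥-elim (star∉ j∈)
    ... | enc (orig _) | enc (orig _) = visible-orig-orig (orig∈⁻ₛ i∈) (orig∈⁻ₛ j∈)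
    ... | enc (orig _) | enc (copy v) = visible-orig-copy (orig∈⁻ₛ i∈) v
    ... | enc (copy u) | enc (orig _) = Visible-sym (visible-orig-copy (orig∈⁻ₛ j∈) u)
    ... | enc (copy u) | enc (copy v) = visible-copy-copy u v

theorem5p4 : ∀ {n} (G : Graph n) → ¬ Complete G → DiamAtMost G 3 →
    ∀ a b c → IsMuO G a → IsMu (Mycielski G) b → IsMu G c →
    (n + a ≤ b × b ≤ n + c + 1) ×
    (b ≡ n + c + 1 → ∀ S → IsMuSet (Mycielski G) S → vstar n ∈ S)
theorem5p4 {n} G ¬complete diam a b c
  ((So , outer , ∣So∣≡a) , _) ((T₀ , mv₀ , ∣T₀∣≡b) , μM≤b) (_ , μ≤c) =
  (lower , upper) , starInMuSet
  where
  lower : n + a ≤ b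
  lower = begin
    n + a              ≡⟨ trans (cong (n +_) (sym ∣So∣≡a)) (+-comm n ∣ So ∣) ⟩
    ∣ So ∣ + n         ≡⟨ sym (∣outerLift∣ So) ⟩
    ∣ outerLift So ∣   ≤⟨ μM≤b _ (outerLift-mutualVisibility G diam ¬complete outer) ⟩
    b                  ∎
    where open ≤-Reasoning

  upper : b ≤ n + c + 1
  upper = subst (_≤ n + c + 1) ∣T₀∣≡b (mutualVisibility-size≤ G diam μ≤c T₀ mv₀)

  starInMuSet : b ≡ n + c + 1 → ∀ S → IsMuSet (Mycielski G) S → vstar n ∈ S
  starInMuSet b≡n+c+1 S (mvS , maximal) with vstar n ∈? S
  ... | yes v*∈S = v*∈S
  ... | no  v*∉S = ⊥-elim (<-irrefl refl (<-≤-trans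
    (starFree-mutualVisibility-size< G diam μ≤c S v*∉S mvS)
    (subst (_≤ ∣ S ∣) (trans ∣T₀∣≡b b≡n+c+1) (maximal T₀ mv₀))))
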